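{- Let $L_1$ and $L_2$ be any two regular languages. Then $GSCO(L_1,L_2)$ is regular.
   Context: For nonempty $x$ and words $w_1,w_2$, $GSCO_x(w_1,w_2)=\{u_1xv_2,\ u_2xv_1 : w_1=u_1xv_1,\ w_2=u_2xv_2\}$. $GSCO(w_1,w_2)=\bigcup_x GSCO_x(w_1,w_2)$ over all nonempty common substrings $x$ of $w_1$ and $w_2$, and for languages $GSCO(L_1,L_2)=\bigcup_{w_1\in L_1,w_2\in L_2}GSCO(w_1,w_2)$. -}

module Defs where

open import Data.Nat using (ℕ)
open import Data.Fin using (Fin)
open import Data.Bool using (Bool; true)
open import Data.List using (List; []; _∷_; _++_; foldl)
open import Data.Product using (Σ; _×_; ∃-syntax; _,_)
open import Data.Sum using (_⊎_)
open import Relation.Binary.PropositionalEquality using (_≡_; _≢_)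
open import Level using (0ℓ; suc)

Word : ℕ → Set
Word k = List (Fin k)

Language : ℕ → Set₁
Language k = Word k → Set

record DFA (k : ℕ) : Set where
  field
    nStates : ℕ
    start   : Fin nStates
    δ       : Fin nStates → Fin k → Fin nStates
    final   : Fin nStates → Bool

  δ* : Fin nStates → Word k → Fin nStates
  δ* q w = foldl δ q w

  Accepts : Word k → Set
  Accepts w = final (δ* start w) ≡ true

Regular : {k : ℕ} → Language k → Set
Regular {k} L = Σ (DFA k) λ D → (w : Word k) → (L w → DFA.Accepts D w) × (DFA.Accepts D w → L w)

GSCOx : {k : ℕ} → Word k → Word k → Word k → Word k → Set
GSCOx x w₁ w₂ w =
  x ≢ [] ×
  ∃[ u₁ ] ∃[ v₁ ] ∃[ u₂ ] ∃[ v₂ ]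
    (w₁ ≡ u₁ ++ x ++ v₁ × w₂ ≡ u₂ ++ x ++ v₂ ×
     (w ≡ u₁ ++ x ++ v₂ ⊎ w ≡ u₂ ++ x ++ v₁))

GSCOw : {k : ℕ} → Word k → Word k → Word k → Set
GSCOw w₁ w₂ w = ∃[ x ] GSCOx x w₁ w₂ w

GSCO : {k : ℕ} → Language k → Language k → Language k
GSCO L₁ L₂ w = ∃[ w₁ ] ∃[ w₂ ] (L₁ w₁ × L₂ w₂ × GSCOw w₁ w₂ w)

-- A common factor x of w₁ = u₁ x v₁ and w₂ = u₂ x v₂ may be shrunk to its first letter a:
-- u₁ x v₂ = u₁ a (x′ v₂), and a single letter is itself a nonempty common factor. So
-- GSCO(L₁, L₂) is the union of the two one-letter crossovers of L₁ with L₂, the words u a v with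
-- u a a prefix of a word of L₁ and a v a suffix of a word of L₂. A deterministic automaton
-- recognises such a crossover by running the automaton of L₁ on u while tracking the set of
-- states the automaton of L₂ may be in after a crossover point; which crossover points are
-- allowed depends only on co-accessibility in the first automaton and accessibility in the
-- second, both decidable by saturating reachable sets of states.
module Submission where

open import Data.Bool using (true)
open import Data.Bool.Properties using () renaming (_≟_ to _≟ᴮ_)
open import Data.Empty using (⊥-elim)
open import Data.Fin as Fin using (Fin; zero)
open import Data.Fin.Properties using (any?; *↔×; 2↔Bool) renaming (_≟_ to _≟ᶠ_)
open import Data.Fin.Subset using (Subset; _∈_; _⊆_; _⊂_; ⁅_⁆; ∣_∣) renaming (⊥ to ∅)
open import Data.Fin.Subset.Properties
  using (_∈?_; _⊂?_; ⊆-antisym; p⊂q⇒∣p∣<∣q∣; ∣p∣≤n; x∈⁅x⁆; x∈⁅y⁆⇒x≡y; ∉⊥)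
open import Data.List using (List; []; _∷_; _++_; foldl)
open import Data.List.Properties using (foldl-++)
open import Data.Nat using (ℕ; suc; _*_; _^_; _≤_; _<_; _≤′_; ≤′-refl; ≤′-step; z≤n; s≤s)
open import Data.Nat.GeneralisedArithmetic using (fold)
open import Data.Nat.Properties using (≤⇒≤′; ≤-total; ≤-<-trans; m<n⇒m<1+n; n<1+n; <⇒≱)
open import Data.Product using (_×_; _,_; proj₁; proj₂; ∃-syntax)
open import Data.Product.Function.NonDependent.Propositional using (_×-↔_)
open import Data.Sum using (_⊎_; inj₁; inj₂) renaming (map to ⊎-map)
open import Data.Vec using (Vec; []; _∷_; tabulate)
open import Data.Vec.Properties using (lookup∘tabulate; []=⇒lookup; lookup⇒[]=)
open import Function using (_∘_; _↔_; Inverse; mk↔ₛ′)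
open import Function.Properties.Inverse using (↔-refl; ↔-trans)
open import Relation.Binary.PropositionalEquality using (_≡_; refl; sym; trans; cong; subst)
open import Relation.Nullary using (Dec; yes; no; ¬_; does; contradiction)
open import Relation.Nullary.Decidable using (dec-true; map′; _×-dec_; _⊎-dec_)
open import Relation.Unary as U using (Decidable; _≐_; _∪_)
open import Relation.Unary.Properties using (≐-sym; ≐-trans)
open import Defs

private
  variable
    k n : ℕ

dec-true⁻ : {A : Set} (a? : Dec A) → does a? ≡ true → A
dec-true⁻ (yes a) _ = a

select : {P : Fin n → Set} → Decidable P → Subset n
select P? = tabulate (does ∘ P?)

module _ {P : Fin n → Set} (P? : Decidable P) {x : Fin n} where

  ∈-select⁺ : P x → x ∈ select P?
  ∈-select⁺ px = lookup⇒[]= x _ (trans (lookup∘tabulate _ x) (dec-true (P? x) px))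

  ∈-select⁻ : x ∈ select P? → P x
  ∈-select⁻ x∈ = dec-true⁻ (P? x) (trans (sym (lookup∘tabulate _ x)) ([]=⇒lookup x∈))

module _ (f : Subset n → Subset n) (inflationary : ∀ S → S ⊆ f S) (S : Subset n) where

  fold-mono : ∀ {i j} → i ≤′ j → fold S f i ⊆ fold S f j
  fold-mono ≤′-refl         = λ x∈ → x∈
  fold-mono (≤′-step i≤′j) = inflationary _ ∘ fold-mono i≤′j

  fixedPoint-persists : ∀ {i j} → f (fold S f i) ≡ fold S f i → i ≤′ j → fold S f j ≡ fold S f i
  fixedPoint-persists fix ≤′-refl         = refl
  fixedPoint-persists fix (≤′-step i≤′j) = trans (cong f (fixedPoint-persists fix i≤′j)) fix

  not-strictly-inflated⇒fixed : ∀ T → ¬ (T ⊂ f T) → f T ≡ T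
  not-strictly-inflated⇒fixed T ¬T⊂fT = ⊆-antisym fT⊆T (inflationary T)
    where
      fT⊆T : f T ⊆ T
      fT⊆T {x} x∈fT with x ∈? T
      ... | yes x∈T = x∈T
      ... | no  x∉T = contradiction ((λ {y} → inflationary T {y}) , x , x∈fT , x∉T) ¬T⊂fT

  fixed-or-growing : ∀ m → (∃[ j ] j < m × f (fold S f j) ≡ fold S f j) ⊎ m ≤ ∣ fold S f m ∣
  fixed-or-growing 0 = inj₂ z≤n
  fixed-or-growing (suc m) with fixed-or-growing m
  ... | inj₁ (j , j<m , fix) = inj₁ (j , m<n⇒m<1+n j<m , fix)
  ... | inj₂ m≤∣Sₘ∣ with fold S f m ⊂? f (fold S f m)
  ...   | yes Sₘ⊂fSₘ = inj₂ (≤-<-trans m≤∣Sₘ∣ (p⊂q⇒∣p∣<∣q∣ Sₘ⊂fSₘ))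
  ...   | no ¬Sₘ⊂fSₘ = inj₁ (m , n<1+n m , not-strictly-inflated⇒fixed _ ¬Sₘ⊂fSₘ)

  -- A strictly growing chain of subsets of Fin n has at most n steps.
  fixedPoint-within : ∃[ j ] j ≤ n × f (fold S f j) ≡ fold S f j
  fixedPoint-within with fixed-or-growing (suc n)
  ... | inj₁ (j , s≤s j≤n , fix) = j , j≤n , fix
  ... | inj₂ n<∣Sₙ₊₁∣             = contradiction (∣p∣≤n (fold S f (suc n))) (<⇒≱ n<∣Sₙ₊₁∣)

  fold-stabilises : ∀ j → fold S f j ⊆ fold S f n
  fold-stabilises j with fixedPoint-within
  ... | i , i≤n , fix with ≤-total j i
  ...   | inj₁ j≤i = fold-mono (≤⇒≤′ i≤n) ∘ fold-mono (≤⇒≤′ j≤i)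
  ...   | inj₂ i≤j rewrite fixedPoint-persists fix (≤⇒≤′ i≤j) = fold-mono (≤⇒≤′ i≤n)

module Reachability (δ : Fin n → Fin k → Fin n) where

  Reachable : Fin n → Fin n → Set
  Reachable p r = ∃[ w ] foldl δ p w ≡ r

  ReachedInOneStep : Subset n → Fin n → Set
  ReachedInOneStep S r = (r ∈ S) ⊎ (∃[ q ] q ∈ S × ∃[ b ] δ q b ≡ r)

  reachedInOneStep? : ∀ S → Decidable (ReachedInOneStep S)
  reachedInOneStep? S r = (r ∈? S) ⊎-dec any? (λ q → (q ∈? S) ×-dec any? (λ b → δ q b ≟ᶠ r))

  expand : Subset n → Subset n
  expand S = select (reachedInOneStep? S)

  expand-inflationary : ∀ S → S ⊆ expand S
  expand-inflationary S r∈S = ∈-select⁺ (reachedInOneStep? S) (inj₁ r∈S)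

  reachedWithin : Fin n → ℕ → Subset n
  reachedWithin p = fold ⁅ p ⁆ expand

  reachedWithin-sound : ∀ {p} j {r} → r ∈ reachedWithin p j → Reachable p r
  reachedWithin-sound {p} 0 {r} r∈ = [] , sym (x∈⁅y⁆⇒x≡y p r∈)
  reachedWithin-sound {p} (suc j) r∈ with ∈-select⁻ (reachedInOneStep? _) r∈
  ... | inj₁ r∈′ = reachedWithin-sound j r∈′
  ... | inj₂ (q , q∈ , b , refl) with reachedWithin-sound j q∈
  ...   | w , refl = w ++ b ∷ [] , foldl-++ δ p w (b ∷ [])

  reachedWithin-complete : ∀ {p} w {j q} → q ∈ reachedWithin p j →
                           ∃[ i ] foldl δ q w ∈ reachedWithin p i
  reachedWithin-complete []      {j} q∈ = j , q∈
  reachedWithin-complete (b ∷ w) {j} {q} q∈ =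
    reachedWithin-complete w {suc j} (∈-select⁺ (reachedInOneStep? _) (inj₂ (q , q∈ , b , refl)))

  reachable? : ∀ p r → Dec (Reachable p r)
  reachable? p r = map′ (reachedWithin-sound {p} n) complete (r ∈? reachedWithin p n)
    where
      complete : Reachable p r → r ∈ reachedWithin p n
      complete (w , refl) with reachedWithin-complete w {0} (x∈⁅x⁆ p)
      ... | i , r∈ = fold-stabilises expand expand-inflationary ⁅ p ⁆ i r∈

  reachesSome? : {P : Fin n → Set} → Decidable P → ∀ p → Dec (∃[ w ] P (foldl δ p w))
  reachesSome? P? p = map′ (λ { (_ , (w , refl) , Pr) → w , Pr })
                           (λ { (w , Pw) → _ , (w , refl) , Pw })
                           (any? λ r → reachable? p r ×-dec P? r)

Finite : Set → Set
Finite A = ∃[ m ] Fin m ↔ A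

Fin-finite : ∀ n → Finite (Fin n)
Fin-finite n = n , ↔-refl

×-finite : {A B : Set} → Finite A → Finite B → Finite (A × B)
×-finite (m , Fin↔A) (m′ , Fin↔B) = m * m′ , ↔-trans *↔× (Fin↔A ×-↔ Fin↔B)

∷-↔ : {A : Set} → (A × Vec A n) ↔ Vec A (suc n)
∷-↔ = mk↔ₛ′ (λ (x , xs) → x ∷ xs) (λ { (x ∷ xs) → x , xs }) (λ { (x ∷ xs) → refl }) (λ { (x , xs) → refl })

Fin[2^n]↔Subset : ∀ n → Fin (2 ^ n) ↔ Subset n
Fin[2^n]↔Subset 0       = mk↔ₛ′ (λ _ → []) (λ _ → zero) (λ { [] → refl }) (λ { zero → refl ; (Fin.suc ()) })
Fin[2^n]↔Subset (suc n) = ↔-trans *↔× (↔-trans (2↔Bool ×-↔ Fin[2^n]↔Subset n) ∷-↔)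

Subset-finite : ∀ n → Finite (Subset n)
Subset-finite n = 2 ^ n , Fin[2^n]↔Subset n

automaton-regular : {A : Set} → Finite A → (step : A → Fin k → A) (start : A) →
                    {Accepting : A → Set} → Decidable Accepting →
                    Regular (λ w → Accepting (foldl step start w))
automaton-regular {k} (m , Fin↔A) step start {Accepting} accepting? = D , λ w → accepts⇔ w
  where
    open Inverse Fin↔A using (to; from; strictlyInverseˡ)

    D : DFA k
    D = record { nStates = m ; start = from start ; δ = λ i b → from (step (to i) b)
               ; final = λ i → does (accepting? (to i)) }

    decode-run : ∀ w a → to (foldl (DFA.δ D) (from a) w) ≡ foldl step a w
    decode-run []      a = strictlyInverseˡ a
    decode-run (b ∷ w) a rewrite strictlyInverseˡ a = decode-run w (step a b)

    accepts⇔ : ∀ w → (Accepting (foldl step start w) → DFA.Accepts D w) ×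
                     (DFA.Accepts D w → Accepting (foldl step start w))
    accepts⇔ w rewrite decode-run w start = dec-true (accepting? _) , dec-true⁻ (accepting? _)

regular-resp : {L M : Language k} → L ≐ M → Regular L → Regular M
regular-resp (L⊆M , M⊆L) (D , accepts) =
  D , λ w → proj₁ (accepts w) ∘ M⊆L , L⊆M ∘ proj₂ (accepts w)

accepts≐ : {L : Language k} (r : Regular L) → DFA.Accepts (proj₁ r) ≐ L
accepts≐ (_ , accepts) = (λ {w} → proj₂ (accepts w)) , (λ {w} → proj₁ (accepts w))

pairwise : {A B C : Set} → (A → C → A) → (B → C → B) → A × B → C → A × B
pairwise f g (a , b) c = f a c , g b c

foldl-pairwise : {A B C : Set} (f : A → C → A) (g : B → C → B) (a : A) (b : B) (cs : List C) →
                 foldl (pairwise f g) (a , b) cs ≡ (foldl f a cs , foldl g b cs)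
foldl-pairwise f g a b []       = refl
foldl-pairwise f g a b (c ∷ cs) = foldl-pairwise f g (f a c) (g b c) cs

∪-cong : {L₁ L₂ M₁ M₂ : Language k} → L₁ ≐ M₁ → L₂ ≐ M₂ → (L₁ ∪ L₂) ≐ (M₁ ∪ M₂)
∪-cong (L₁⊆M₁ , M₁⊆L₁) (L₂⊆M₂ , M₂⊆L₂) = ⊎-map L₁⊆M₁ L₂⊆M₂ , ⊎-map M₁⊆L₁ M₂⊆L₂

regular-∪ : {L M : Language k} → Regular L → Regular M → Regular (L ∪ M)
regular-∪ {k} r₁@(D₁ , _) r₂@(D₂ , _) =
  regular-resp (≐-trans product≐ (∪-cong (accepts≐ r₁) (accepts≐ r₂)))
    (automaton-regular (×-finite (Fin-finite n₁) (Fin-finite n₂)) (pairwise δ₁ δ₂) (s₁ , s₂) accepting?)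
  where
    open DFA D₁ using () renaming (nStates to n₁; start to s₁; δ to δ₁; final to final₁)
    open DFA D₂ using () renaming (nStates to n₂; start to s₂; δ to δ₂; final to final₂)

    Accepting : Fin n₁ × Fin n₂ → Set
    Accepting (p , q) = final₁ p ≡ true ⊎ final₂ q ≡ true

    accepting? : Decidable Accepting
    accepting? (p , q) = (final₁ p ≟ᴮ true) ⊎-dec (final₂ q ≟ᴮ true)

    runs : ∀ w → foldl (pairwise δ₁ δ₂) (s₁ , s₂) w ≡ (foldl δ₁ s₁ w , foldl δ₂ s₂ w)
    runs = foldl-pairwise δ₁ δ₂ s₁ s₂

    product≐ : (λ w → Accepting (foldl (pairwise δ₁ δ₂) (s₁ , s₂) w)) ≐ (DFA.Accepts D₁ ∪ DFA.Accepts D₂)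
    product≐ = (λ {w} → subst Accepting (runs w)) , (λ {w} → subst Accepting (sym (runs w)))

LetterCrossover : Language k → Language k → Language k
LetterCrossover L₁ L₂ w =
  ∃[ u ] ∃[ a ] ∃[ v ] w ≡ u ++ a ∷ v × (∃[ v′ ] L₁ (u ++ a ∷ v′)) × (∃[ u′ ] L₂ (u′ ++ a ∷ v))

LetterCrossover-mono : {L₁ L₂ M₁ M₂ : Language k} → L₁ U.⊆ M₁ → L₂ U.⊆ M₂ →
                       LetterCrossover L₁ L₂ U.⊆ LetterCrossover M₁ M₂
LetterCrossover-mono L₁⊆M₁ L₂⊆M₂ (u , a , v , w≡ , (v′ , l₁) , (u′ , l₂)) =
  u , a , v , w≡ , (v′ , L₁⊆M₁ l₁) , (u′ , L₂⊆M₂ l₂)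

LetterCrossover-cong : {L₁ L₂ M₁ M₂ : Language k} → L₁ ≐ M₁ → L₂ ≐ M₂ →
                       LetterCrossover L₁ L₂ ≐ LetterCrossover M₁ M₂
LetterCrossover-cong {L₁ = L₁} {L₂} {M₁} {M₂} (L₁⊆M₁ , M₁⊆L₁) (L₂⊆M₂ , M₂⊆L₂) =
  LetterCrossover-mono {L₁ = L₁} {L₂} L₁⊆M₁ L₂⊆M₂ , LetterCrossover-mono {L₁ = M₁} {M₂} M₁⊆L₁ M₂⊆L₂

GSCO⊆LetterCrossovers : (L₁ L₂ : Language k) →
                        GSCO L₁ L₂ U.⊆ (LetterCrossover L₁ L₂ ∪ LetterCrossover L₂ L₁)
GSCO⊆LetterCrossovers L₁ L₂ (_ , _ , _ , _ , [] , x≢[] , _) = ⊥-elim (x≢[] refl)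
GSCO⊆LetterCrossovers L₁ L₂ (_ , _ , l₁ , l₂ , a ∷ x , _ , u₁ , v₁ , u₂ , v₂ , refl , refl , inj₁ w≡) =
  inj₁ (u₁ , a , x ++ v₂ , w≡ , (x ++ v₁ , l₁) , (u₂ , l₂))
GSCO⊆LetterCrossovers L₁ L₂ (_ , _ , l₁ , l₂ , a ∷ x , _ , u₁ , v₁ , u₂ , v₂ , refl , refl , inj₂ w≡) =
  inj₂ (u₂ , a , x ++ v₁ , w≡ , (x ++ v₂ , l₂) , (u₁ , l₁))

LetterCrossovers⊆GSCO : (L₁ L₂ : Language k) →
                        (LetterCrossover L₁ L₂ ∪ LetterCrossover L₂ L₁) U.⊆ GSCO L₁ L₂
LetterCrossovers⊆GSCO L₁ L₂ (inj₁ (u , a , v , w≡ , (v′ , l₁) , (u′ , l₂))) =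
  _ , _ , l₁ , l₂ , a ∷ [] , (λ ()) , u , v′ , u′ , v , refl , refl , inj₁ w≡
LetterCrossovers⊆GSCO L₁ L₂ (inj₂ (u , a , v , w≡ , (v′ , l₂) , (u′ , l₁))) =
  _ , _ , l₁ , l₂ , a ∷ [] , (λ ()) , u′ , v , u , v′ , refl , refl , inj₂ w≡

GSCO≐LetterCrossovers : (L₁ L₂ : Language k) →
                        GSCO L₁ L₂ ≐ (LetterCrossover L₁ L₂ ∪ LetterCrossover L₂ L₁)
GSCO≐LetterCrossovers L₁ L₂ = GSCO⊆LetterCrossovers L₁ L₂ , LetterCrossovers⊆GSCO L₁ L₂

module Crossover (D₁ D₂ : DFA k) where
  open DFA D₁ using () renaming (nStates to n₁; start to s₁; δ to δ₁; final to final₁)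
  open DFA D₂ using () renaming (nStates to n₂; start to s₂; δ to δ₂; final to final₂)

  CoAccessible : Fin n₁ → Set
  CoAccessible q = ∃[ v ] final₁ (foldl δ₁ q v) ≡ true

  EntryState : Fin k → Fin n₂ → Set
  EntryState a r = ∃[ u ] δ₂ (foldl δ₂ s₂ u) a ≡ r

  coAccessible? : Decidable CoAccessible
  coAccessible? = Reachability.reachesSome? δ₁ (λ q → final₁ q ≟ᴮ true)

  entryState? : ∀ a → Decidable (EntryState a)
  entryState? a r = Reachability.reachesSome? δ₂ (λ p → δ₂ p a ≟ᶠ r) s₂

  -- The state of D₁ on the input read so far, and the states D₂ may be in if a crossover
  -- point has already been passed.
  State : Set
  State = Fin n₁ × Subset n₂

  Successor : State → Fin k → Fin n₂ → Set
  Successor (q , S) b r = (∃[ p ] p ∈ S × δ₂ p b ≡ r) ⊎ (CoAccessible (δ₁ q b) × EntryState b r)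

  successor? : ∀ s b → Decidable (Successor s b)
  successor? (q , S) b r =
    any? (λ p → (p ∈? S) ×-dec (δ₂ p b ≟ᶠ r)) ⊎-dec (coAccessible? (δ₁ q b) ×-dec entryState? b r)

  step : State → Fin k → State
  step (q , S) b = δ₁ q b , select (successor? (q , S) b)

  Accepting : State → Set
  Accepting (q , S) = ∃[ r ] r ∈ S × final₂ r ≡ true

  accepting? : Decidable Accepting
  accepting? (q , S) = any? λ r → (r ∈? S) ×-dec (final₂ r ≟ᴮ true)

  LeadsToAcceptance : Subset n₂ → Word k → Set
  LeadsToAcceptance S w = ∃[ r ] r ∈ S × final₂ (foldl δ₂ r w) ≡ true

  CrossesOver : Fin n₁ → Word k → Set
  CrossesOver q w = ∃[ u ] ∃[ a ] ∃[ v ] w ≡ u ++ a ∷ v × CoAccessible (δ₁ (foldl δ₁ q u) a) ×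
                    (∃[ r ] EntryState a r × final₂ (foldl δ₂ r v) ≡ true)

  run-accepting⁻ : ∀ w {q S} → Accepting (foldl step (q , S) w) → LeadsToAcceptance S w ⊎ CrossesOver q w
  run-accepting⁻ []                 acc = inj₁ acc
  run-accepting⁻ (b ∷ w) {q} {S} acc with run-accepting⁻ w acc
  ... | inj₂ (u , a , v , refl , co , entry) = inj₂ (b ∷ u , a , v , refl , co , entry)
  ... | inj₁ (r , r∈ , fin) with ∈-select⁻ (successor? (q , S) b) r∈
  ...   | inj₁ (p , p∈S , refl)  = inj₁ (p , p∈S , fin)
  ...   | inj₂ (co , entry)      = inj₂ ([] , b , w , refl , co , r , entry , fin)

  run-accepting⁺ : ∀ w {q S} → LeadsToAcceptance S w ⊎ CrossesOver q w → Accepting (foldl step (q , S) w)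
  run-accepting⁺ []      (inj₁ acc) = acc
  run-accepting⁺ []      (inj₂ ([]    , _ , _ , () , _))
  run-accepting⁺ []      (inj₂ (_ ∷ _ , _ , _ , () , _))
  run-accepting⁺ (b ∷ w) {q} {S} (inj₁ (r , r∈S , fin)) =
    run-accepting⁺ w (inj₁ (δ₂ r b , ∈-select⁺ (successor? (q , S) b) (inj₁ (r , r∈S , refl)) , fin))
  run-accepting⁺ (b ∷ w) {q} {S} (inj₂ ([] , _ , _ , refl , co , r , entry , fin)) =
    run-accepting⁺ w (inj₁ (r , ∈-select⁺ (successor? (q , S) b) (inj₂ (co , entry)) , fin))
  run-accepting⁺ (b ∷ w) (inj₂ (_ ∷ u , a , v , refl , crossing)) =
    run-accepting⁺ w (inj₂ (u , a , v , refl , crossing))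

  CrossesOver≐LetterCrossover : CrossesOver s₁ ≐ LetterCrossover (DFA.Accepts D₁) (DFA.Accepts D₂)
  CrossesOver≐LetterCrossover = to , from
    where
      to : CrossesOver s₁ U.⊆ LetterCrossover (DFA.Accepts D₁) (DFA.Accepts D₂)
      to (u , a , v , w≡ , (v′ , acc₁) , (_ , (u′ , refl) , acc₂)) =
        u , a , v , w≡ , (v′ , trans (cong final₁ (foldl-++ δ₁ s₁ u (a ∷ v′))) acc₁)
                       , (u′ , trans (cong final₂ (foldl-++ δ₂ s₂ u′ (a ∷ v))) acc₂)
      from : LetterCrossover (DFA.Accepts D₁) (DFA.Accepts D₂) U.⊆ CrossesOver s₁
      from (u , a , v , w≡ , (v′ , acc₁) , (u′ , acc₂)) =
        u , a , v , w≡ , (v′ , trans (cong final₁ (sym (foldl-++ δ₁ s₁ u (a ∷ v′)))) acc₁)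
                       , (_ , (u′ , refl) , trans (cong final₂ (sym (foldl-++ δ₂ s₂ u′ (a ∷ v)))) acc₂)

  regular : Regular (LetterCrossover (DFA.Accepts D₁) (DFA.Accepts D₂))
  regular = regular-resp (≐-trans started≐ CrossesOver≐LetterCrossover)
              (automaton-regular (×-finite (Fin-finite n₁) (Subset-finite n₂)) step (s₁ , ∅) accepting?)
    where
      nothing-pending : ∀ {w} → LeadsToAcceptance ∅ w ⊎ CrossesOver s₁ w → CrossesOver s₁ w
      nothing-pending (inj₁ (_ , r∈∅ , _)) = ⊥-elim (∉⊥ r∈∅)
      nothing-pending (inj₂ crossing)      = crossing

      started≐ : (λ w → Accepting (foldl step (s₁ , ∅) w)) ≐ CrossesOver s₁
      started≐ = (λ {w} → nothing-pending ∘ run-accepting⁻ w) , (λ {w} → run-accepting⁺ w ∘ inj₂)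

regular-LetterCrossover : {L₁ L₂ : Language k} → Regular L₁ → Regular L₂ → Regular (LetterCrossover L₁ L₂)
regular-LetterCrossover r₁@(D₁ , _) r₂@(D₂ , _) =
  regular-resp (LetterCrossover-cong (accepts≐ r₁) (accepts≐ r₂)) (Crossover.regular D₁ D₂)

mainTheorem6 : (k : ℕ) (L₁ L₂ : Language k) → Regular L₁ → Regular L₂ → Regular (GSCO L₁ L₂)
mainTheorem6 k L₁ L₂ r₁ r₂ =
  regular-resp (≐-sym (GSCO≐LetterCrossovers L₁ L₂))
    (regular-∪ (regular-LetterCrossover r₁ r₂) (regular-LetterCrossover r₂ r₁))
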